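{- For every formula $\varphi \in \mathcal{L}_{CoRGAL}$: if $\varphi$ is valid, then $\varphi \in \mathbf{CoRGAL}$ (i.e. $\varphi$ is a theorem of the axiom system $\mathbf{CoRGAL}$).
   Context: Fix a finite set $A$ of agents and a countable set $P$ of propositional variables. The language $\mathcal{L}_{CoRGAL}$ is given by $\varphi ::= p \mid \neg\varphi \mid (\varphi\wedge\varphi) \mid K_a\varphi \mid [\varphi]\varphi \mid [G,\varphi]\varphi \mid [\langle G\rangle]\varphi$ with $p\in P$, $a\in A$, $G\subseteq A$; usual Boolean abbreviations; $\langle\varphi\rangle\psi:=\neg[\varphi]\neg\psi$, $\langle G,\chi\rangle\varphi:=\neg[G,\chi]\neg\varphi$, $\langle[G]\rangle\varphi := \neg[\langle G\rangle]\neg\varphi$. $\mathcal{L}_{EL}$ is the fragment built only from $p,\neg,\wedge,K_a$. For $G\subseteq A$, $\mathcal{L}_{EL}^G$ is the set of formulas $\bigwedge_{i\in G}K_i\varphi_i$ with each $\varphi_i\in\mathcal{L}_{EL}$; $\psi_G$ always denotes an element of $\mathcal{L}_{EL}^G$ (and $\chi_{A\setminus G}$ an element of $\mathcal{L}_{EL}^{A\setminus G}$). An epistemic model is $M=(W,\sim,V)$ with $W\neq\emptyset$, each $\sim_a$ an equivalence relation on $W$, $V:P\to\mathcal{P}(W)$. For a formula $\varphi$, $M^\varphi$ is the restriction of $M$ to $[\![\varphi]\!]_M=\{v:(M,v)\models\varphi\}$ (relations and valuation intersected accordingly). Semantics: $p$, $\neg$, $\wedge$ as usual; $(M,w)\models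 K_a\varphi$ iff $(M,v)\models\varphi$ for all $v$ with $w\sim_a v$; $(M,w)\models[\varphi]\psi$ iff $(M,w)\models\varphi$ implies $(M^\varphi,w)\models\psi$; $(M,w)\models[G,\chi]\varphi$ iff $(M,w)\models\chi$ and for all $\psi_G$, $(M,w)\models[\psi_G\wedge\chi]\varphi$; $(M,w)\models[\langle G\rangle]\varphi$ iff for all $\psi_G$ there is $\chi_{A\setminus G}$ with $(M,w)\models\psi_G\to\langle\psi_G\wedge\chi_{A\setminus G}\rangle\varphi$. A formula is valid if true at every pointed model $(M,w)$. Necessity forms: $\eta ::= \sharp \mid \varphi\to\eta(\sharp) \mid K_a\eta(\sharp) \mid [\varphi]\eta(\sharp)$ with $\varphi\in\mathcal{L}_{CoRGAL}$; $\sharp$ occurs exactly once and $\eta(\varphi)$ is the result of replacing $\sharp$ by $\varphi$. The axiom system $\mathbf{CoRGAL}$ is the smallest set of formulas containing: (A0) propositional tautologies; (A1) $K_a(\varphi\to\psi)\to(K_a\varphi\to K_a\psi)$; (A2) $K_a\varphi\to\varphi$; (A3) $K_a\varphi\to K_aK_a\varphi$; (A4) $\neg K_a\varphi\to K_a\neg K_a\varphi$; (A5) $[\varphi]p\leftrightarrow(\varphi\to p)$; (A6) $[\varphi]\neg\psi\leftrightarrow(\varphi\to\neg[\varphi]\psi)$; (A7) $[\varphi](\psi\wedge\chi)\leftrightarrow([\varphi]\psi\wedge[\varphi]\chi)$; (A8) $[\varphi]K_a\psi\leftrightarrow(\varphi\to K_a[\varphi]\psi)$; (A9) $[\varphi][\psi]\chi\leftrightarrow[\varphi\wedge[\varphi]\psi]\chi$;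 (A10) $[G,\chi]\varphi\to\chi\wedge[\psi_G\wedge\chi]\varphi$ for any $\psi_G$; (A11) $[\langle G\rangle]\varphi\to\langle A\setminus G,\psi_G\rangle\varphi$ for any $\psi_G$; and closed under: (R0) modus ponens; (R1) from $\varphi$ infer $K_a\varphi$; (R2) from $\varphi$ infer $[\psi]\varphi$; (R3) from $\varphi$ infer $[G,\chi]\varphi$; (R4) from $\varphi$ infer $[\langle G\rangle]\varphi$; (R5) if $\eta(\chi\wedge[\psi_G\wedge\chi]\varphi)$ is derivable for all $\psi_G$, infer $\eta([G,\chi]\varphi)$; (R6) if $\eta(\langle A\setminus G,\psi_G\rangle\varphi)$ is derivable for all $\psi_G$, infer $\eta([\langle G\rangle]\varphi)$. -}

module Defs where

open import Data.Nat using (ℕ)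
open import Data.Bool using (Bool; true; false; if_then_else_; not; _∧_)
open import Data.Fin using (Fin)
open import Data.Fin.Subset using (Subset; ∁)
open import Data.Vec using (lookup)
open import Data.List using (foldr; allFin)
open import Data.Product using (Σ; _×_; _,_; proj₁)
open import Data.Empty using (⊥)
open import Relation.Nullary using (¬_)
open import Relation.Binary.PropositionalEquality using (_≡_)
open import Relation.Binary.Structures using (IsEquivalence)

infixr 6 _∧'_
infixr 5 _⇒_

data Form (n : ℕ) : Set where
  var     : ℕ → Form n
  ¬'_     : Form n → Form n
  _∧'_    : Form n → Form n → Form n
  K       : Fin n → Form n → Form n
  [_]_    : Form n → Form n → Form n
  [_∣_]_  : Subset n → Form n → Form n → Form n
  [⟨_⟩]_  : Subset n → Form n → Form n

_⇒_ : ∀ {n} → Form n → Form n → Form n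
φ ⇒ ψ = ¬' (φ ∧' ¬' ψ)

_⇔_ : ∀ {n} → Form n → Form n → Form n
φ ⇔ ψ = (φ ⇒ ψ) ∧' (ψ ⇒ φ)

⊤' : ∀ {n} → Form n
⊤' = ¬' (var 0 ∧' ¬' var 0)

⟨_⟩_ : ∀ {n} → Form n → Form n → Form n
⟨ φ ⟩ ψ = ¬' ([ φ ] (¬' ψ))

⟨_∣_⟩_ : ∀ {n} → Subset n → Form n → Form n → Form n
⟨ G ∣ χ ⟩ φ = ¬' ([ G ∣ χ ] (¬' φ))

⟨[_]⟩_ : ∀ {n} → Subset n → Form n → Form n
⟨[ G ]⟩ φ = ¬' ([⟨ G ⟩] (¬' φ))

data ELForm (n : ℕ) : Set where
  var  : ℕ → ELForm n
  ¬'_  : ELForm n → ELForm n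
  _∧'_ : ELForm n → ELForm n → ELForm n
  K    : Fin n → ELForm n → ELForm n

⌜_⌝ : ∀ {n} → ELForm n → Form n
⌜ var p ⌝  = var p
⌜ ¬' φ ⌝   = ¬' ⌜ φ ⌝
⌜ φ ∧' ψ ⌝ = ⌜ φ ⌝ ∧' ⌜ ψ ⌝
⌜ K a φ ⌝  = K a ⌜ φ ⌝

⊤EL : ∀ {n} → ELForm n
⊤EL = ¬' (var 0 ∧' ¬' var 0)

-- L_EL^G: the formulas ⋀_{i∈G} K_i φ_i.  Such a formula is determined by
-- G and a family f : Fin n → ELForm n (only the values f i with i ∈ G
-- matter); the conjunction runs over i ∈ G in increasing order and the
-- empty conjunction is ⊤.
ψ[_∣_] : ∀ {n} → Subset n → (Fin n → ELForm n) → ELForm n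
ψ[ G ∣ f ] = foldr (λ i acc → if lookup G i then K i (f i) ∧' acc else acc)
                   ⊤EL (allFin _)

data NecForm (n : ℕ) : Set where
  ♯    : NecForm n
  imp  : Form n → NecForm n → NecForm n
  Kη   : Fin n → NecForm n → NecForm n
  annη : Form n → NecForm n → NecForm n

_⟪_⟫ : ∀ {n} → NecForm n → Form n → Form n
♯ ⟪ φ ⟫         = φ
imp ψ η ⟪ φ ⟫   = ψ ⇒ (η ⟪ φ ⟫)
Kη a η ⟪ φ ⟫    = K a (η ⟪ φ ⟫)
annη ψ η ⟪ φ ⟫  = [ ψ ] (η ⟪ φ ⟫)

-- Propositional tautologies: formulas true under every Boolean valuation
-- that treats all non-Boolean subformulas (variables, K_a, [·], [G,·],
-- [⟨G⟩]) as propositional atoms.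

evalB : ∀ {n} → (Form n → Bool) → Form n → Bool
evalB v (¬' φ)   = not (evalB v φ)
evalB v (φ ∧' ψ) = evalB v φ ∧ evalB v ψ
evalB v φ        = v φ

Tautology : ∀ {n} → Form n → Set
Tautology φ = ∀ v → evalB v φ ≡ true

data ⊢_ {n : ℕ} : Form n → Set where
  A0  : ∀ {φ} → Tautology φ → ⊢ φ
  A1  : ∀ a φ ψ → ⊢ (K a (φ ⇒ ψ) ⇒ (K a φ ⇒ K a ψ))
  A2  : ∀ a φ → ⊢ (K a φ ⇒ φ)
  A3  : ∀ a φ → ⊢ (K a φ ⇒ K a (K a φ))
  A4  : ∀ a φ → ⊢ (¬' K a φ ⇒ K a (¬' K a φ))
  A5  : ∀ φ p → ⊢ (([ φ ] var p) ⇔ (φ ⇒ var p))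
  A6  : ∀ φ ψ → ⊢ (([ φ ] (¬' ψ)) ⇔ (φ ⇒ ¬' ([ φ ] ψ)))
  A7  : ∀ φ ψ χ → ⊢ (([ φ ] (ψ ∧' χ)) ⇔ (([ φ ] ψ) ∧' ([ φ ] χ)))
  A8  : ∀ φ a ψ → ⊢ (([ φ ] K a ψ) ⇔ (φ ⇒ K a ([ φ ] ψ)))
  A9  : ∀ φ ψ χ → ⊢ (([ φ ] ([ ψ ] χ)) ⇔ ([ φ ∧' ([ φ ] ψ) ] χ))
  A10 : ∀ G χ φ f → ⊢ (([ G ∣ χ ] φ) ⇒ (χ ∧' ([ ⌜ ψ[ G ∣ f ] ⌝ ∧' χ ] φ)))
  A11 : ∀ G φ f → ⊢ (([⟨ G ⟩] φ) ⇒ (⟨ ∁ G ∣ ⌜ ψ[ G ∣ f ] ⌝ ⟩ φ))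
  R0  : ∀ {φ ψ} → ⊢ (φ ⇒ ψ) → ⊢ φ → ⊢ ψ
  R1  : ∀ {φ} a → ⊢ φ → ⊢ (K a φ)
  R2  : ∀ {φ} ψ → ⊢ φ → ⊢ ([ ψ ] φ)
  R3  : ∀ {φ} G χ → ⊢ φ → ⊢ ([ G ∣ χ ] φ)
  R4  : ∀ {φ} G → ⊢ φ → ⊢ ([⟨ G ⟩] φ)
  R5  : ∀ η G χ φ →
        (∀ f → ⊢ (η ⟪ χ ∧' ([ ⌜ ψ[ G ∣ f ] ⌝ ∧' χ ] φ) ⟫)) →
        ⊢ (η ⟪ [ G ∣ χ ] φ ⟫)
  R6  : ∀ η G φ →
        (∀ f → ⊢ (η ⟪ ⟨ ∁ G ∣ ⌜ ψ[ G ∣ f ] ⌝ ⟩ φ ⟫)) →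
        ⊢ (η ⟪ [⟨ G ⟩] φ ⟫)

record Model (n : ℕ) : Set₁ where
  field
    W     : Set
    R     : Fin n → W → W → Set
    equiv : ∀ a → IsEquivalence (R a)
    V     : ℕ → W → Set
open Model public

_↾_ : ∀ {n} (M : Model n) → (W M → Set) → Model n
M ↾ D = record
  { W     = Σ (W M) D
  ; R     = λ a u v → R M a (proj₁ u) (proj₁ v)
  ; equiv = λ a → record
      { refl  = IsEquivalence.refl (equiv M a)
      ; sym   = IsEquivalence.sym (equiv M a)
      ; trans = IsEquivalence.trans (equiv M a) }
  ; V     = λ p u → V M p (proj₁ u)
  }

satEL : ∀ {n} (M : Model n) → W M → ELForm n → Set
satEL M w (var p)  = V M p w
satEL M w (¬' φ)   = ¬ satEL M w φ
satEL M w (φ ∧' ψ) = satEL M w φ × satEL M w ψ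
satEL M w (K a φ)  = ∀ v → R M a w v → satEL M v φ

-- The clause for [φ]ψ evaluates ψ in M^φ = M ↾ ⟦φ⟧_M;
-- in the clauses for [G,χ] and [⟨G⟩] the public announcement semantics
-- of [ψ_G ∧ χ]φ and ⟨ψ_G ∧ χ_{A∖G}⟩φ = ¬[ψ_G ∧ χ_{A∖G}]¬φ is unfolded.
infix 2 _▸_⊨_
_▸_⊨_ : ∀ {n} (M : Model n) → W M → Form n → Set
M ▸ w ⊨ var p    = V M p w
M ▸ w ⊨ ¬' φ     = ¬ (M ▸ w ⊨ φ)
M ▸ w ⊨ (φ ∧' ψ) = (M ▸ w ⊨ φ) × (M ▸ w ⊨ ψ)
M ▸ w ⊨ K a φ    = ∀ v → R M a w v → M ▸ v ⊨ φ
M ▸ w ⊨ [ φ ] ψ  = (h : M ▸ w ⊨ φ) → (M ↾ (λ v → M ▸ v ⊨ φ)) ▸ (w , h) ⊨ ψ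
M ▸ w ⊨ [ G ∣ χ ] φ =
  (M ▸ w ⊨ χ) ×
  (∀ f → (h : satEL M w ψ[ G ∣ f ] × (M ▸ w ⊨ χ)) →
     (M ↾ (λ v → satEL M v ψ[ G ∣ f ] × (M ▸ v ⊨ χ))) ▸ (w , h) ⊨ φ)
M ▸ w ⊨ [⟨ G ⟩] φ =
  ∀ f → Σ (Fin _ → ELForm _) λ g →
    (satEL M w ψ[ G ∣ f ] →
      ¬ ((h : satEL M w ψ[ G ∣ f ] × satEL M w ψ[ ∁ G ∣ g ]) →
          ¬ ((M ↾ (λ v → satEL M v ψ[ G ∣ f ] × satEL M v ψ[ ∁ G ∣ g ]))
               ▸ (w , h) ⊨ φ)))

Valid : ∀ {n} → Form n → Set₁
Valid φ = ∀ (M : Model _) (w : W M) → M ▸ w ⊨ φ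

module Submission where

-- The proof is the canonical-model construction for logics with infinitary
-- rules, assuming excluded middle.  A formula that is not a theorem has a
-- consistent negation; a Lindenbaum construction extends it to a maximal
-- consistent set that is closed under the infinitary rules R5 and R6 in every
-- necessity form η (whenever η⟪[G,χ]φ⟫ or η⟪[⟨G⟩]φ⟫ is refuted, one premise is
-- refuted as well).  Such sets, related by the K_a-projections, form the
-- canonical model, and the truth lemma "φ ∈ x iff (Mᶜ,x) ⊨ φ" holds by
-- well-founded induction on a measure (depth, size) that decreases along the
-- reduction axioms A5–A9 and from conclusions to premises of R5/R6.

open import Defs
open import Data.Nat
  using (ℕ; zero; suc; _+_; _*_; _<_; _≤_; _≤′_; ≤′-reflexive; ≤′-step; _⊔_; s≤s; z≤n; NonZero)
open import Data.Nat.Properties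
open import Data.Nat.Tactic.RingSolver using (solve-∀)
open import Data.Nat.Induction using (<-wellFounded)
open import Level using (0ℓ)
open import Axiom.ExcludedMiddle using (ExcludedMiddle)
open import Axiom.DoubleNegationElimination using (em⇒dne)
open import Data.Bool using (Bool; true; false; not; _∧_; T; T?)
open import Data.Bool.Properties using (T-∧; T-≡)
open import Data.Fin using (Fin) renaming (zero to #0; suc to 1+)
open import Data.Fin.Subset using (Subset; ∁)
open import Data.Vec using (Vec; []; _∷_; lookup)
import Data.Vec as Vec
open import Data.Vec.Properties using (lookup-map)
open import Data.List using (List; []; _∷_; map; _++_; concat; cartesianProductWith; cartesianProduct; upTo; allFin)
open import Data.List.Membership.Propositional using (_∈_)
open import Data.List.Membership.Propositional.Properties
  using (∈-map⁺; ∈-++⁺ˡ; ∈-++⁺ʳ; ∈-concat⁺; ∈-cartesianProductWith⁺; ∈-cartesianProduct⁺;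
         ∈-upTo⁺; ∈-allFin)
open import Data.List.Relation.Unary.Any using (Any; here; there)
open import Data.Product using (Σ; _×_; _,_; proj₁; proj₂)
open import Data.Product.Relation.Binary.Lex.Strict using (×-Lex; ×-wellFounded)
open import Data.Product.Function.NonDependent.Propositional using (_×-⇔_)
open import Data.Sum using (_⊎_; inj₁; inj₂)
import Data.Sum as Sum
open import Data.Empty using (⊥; ⊥-elim)
open import Relation.Nullary using (¬_; Dec; yes; no)
open import Relation.Nullary.Decidable using (isYes; toWitness; fromWitness; decidable-stable)
open import Relation.Binary.PropositionalEquality using (_≡_; refl; sym; cong; cong₂; trans; subst)
open import Relation.Binary.Structures using (IsEquivalence)
import Relation.Binary.Construct.On as On
open import Induction.WellFounded using (WellFounded; module Subrelation; module All)
open import Function.Bundles using (mk⇔; module Equivalence) renaming (_⇔_ to _⟺_)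
open import Function.Properties.Equivalence using (⇔-isEquivalence)
open import Function.Related.TypeIsomorphisms using (¬-cong-⇔; →-cong-⇔)

open Equivalence using (to; from)
open IsEquivalence (⇔-isEquivalence {0ℓ})
  using () renaming (refl to ⟺-refl; sym to ⟺-sym; trans to ⟺-trans)

Π-⟺ : {I : Set} {P Q : I → Set} → (∀ i → P i ⟺ Q i) → (∀ i → P i) ⟺ (∀ i → Q i)
Π-⟺ PQ = mk⇔ (λ p i → to (PQ i) (p i)) (λ q i → from (PQ i) (q i))

Σ-⟺ : {I : Set} {P Q : I → Set} → (∀ i → P i ⟺ Q i) → Σ I P ⟺ Σ I Q
Σ-⟺ PQ = mk⇔ (λ (i , p) → i , to (PQ i) p) (λ (i , q) → i , from (PQ i) q)

-- A bisimulation between two epistemic models.  Truth is invariant under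
-- bisimulation; this is how truth is transported between restricted models.
record Bisim {n} (M N : Model n) (Z : W M → W N → Set) : Set where
  field
    atom  : ∀ {w v} p → Z w v → V M p w ⟺ V N p v
    forth : ∀ {w v} a w' → Z w v → R M a w w' → Σ (W N) λ v' → R N a v v' × Z w' v'
    back  : ∀ {w v} a v' → Z w v → R N a v v' → Σ (W M) λ w' → R M a w w' × Z w' v'

module _ {n} {M N : Model n} {Z : W M → W N → Set} (B : Bisim M N Z) where
  open Bisim B

  box-cong : ∀ a {P : W M → Set} {Q : W N → Set} → (∀ {w v} → Z w v → P w ⟺ Q v) →
             ∀ {w v} → Z w v → (∀ w' → R M a w w' → P w') ⟺ (∀ v' → R N a v v' → Q v')
  box-cong a PQ z = mk⇔
    (λ h v' r → let (w' , r' , z') = back a v' z r in to (PQ z') (h w' r'))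
    (λ h w' r → let (v' , r' , z') = forth a w' z r in from (PQ z') (h v' r'))

  satEL-cong : ∀ {w v} → Z w v → (e : ELForm n) → satEL M w e ⟺ satEL N v e
  satEL-cong z (var p)   = atom p z
  satEL-cong z (¬' e)    = ¬-cong-⇔ (satEL-cong z e)
  satEL-cong z (e ∧' e') = satEL-cong z e ×-⇔ satEL-cong z e'
  satEL-cong z (K a e)   = box-cong a (λ z' → satEL-cong z' e) z

  restrict : (D : W M → Set) (D' : W N → Set) → (∀ {w v} → Z w v → D w ⟺ D' v) →
             Bisim (M ↾ D) (N ↾ D') (λ u u' → Z (proj₁ u) (proj₁ u'))
  restrict D D' DD' = record
    { atom  = λ p z → atom p z
    ; forth = λ a (w' , d) z r → let (v' , r' , z') = forth a w' z r in (v' , to (DD' z') d) , r' , z'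
    ; back  = λ a (v' , d) z r → let (w' , r' , z') = back a v' z r in (w' , from (DD' z') d) , r' , z'
    }

Invariant : ∀ {n} → Form n → Set₁
Invariant {n} φ = ∀ {M N : Model n} {Z} → Bisim M N Z →
                  ∀ {w v} → Z w v → (M ▸ w ⊨ φ) ⟺ (N ▸ v ⊨ φ)

announce-cong : ∀ {n} (θ : Form n) → Invariant θ →
                ∀ {M N : Model n} {Z} (B : Bisim M N Z) (D : W M → Set) (D' : W N → Set)
                (DD' : ∀ {w v} → Z w v → D w ⟺ D' v) → ∀ {w v} → Z w v →
                ((d : D w) → (M ↾ D) ▸ (w , d) ⊨ θ) ⟺ ((d : D' v) → (N ↾ D') ▸ (v , d) ⊨ θ)
announce-cong θ inv {M} {N} {Z} B D D' DD' z = mk⇔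
  (λ H d → to (inv B' z) (H (from (DD' z) d)))
  (λ H d → from (inv B' z) (H (to (DD' z) d)))
  where
  B' : Bisim (M ↾ D) (N ↾ D') (λ u u' → Z (proj₁ u) (proj₁ u'))
  B' = restrict B D D' DD'

invariance : ∀ {n} (φ : Form n) → Invariant φ
invariance (var p)  B z = Bisim.atom B p z
invariance (¬' φ)   B z = ¬-cong-⇔ (invariance φ B z)
invariance (φ ∧' ψ) B z = invariance φ B z ×-⇔ invariance ψ B z
invariance (K a φ)  B z = box-cong B a (invariance φ B) z
invariance ([ φ ] ψ) B z = announce-cong ψ (invariance ψ) B _ _ (invariance φ B) z
invariance ([ G ∣ χ ] θ) B z =
  invariance χ B z ×-⇔ Π-⟺ λ f →
    announce-cong θ (invariance θ) B _ _ (λ z' → satEL-cong B z' ψ[ G ∣ f ] ×-⇔ invariance χ B z') z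
invariance ([⟨ G ⟩] θ) B z =
  Π-⟺ λ f → Σ-⟺ λ g → →-cong-⇔ (satEL-cong B z ψ[ G ∣ f ])
    (¬-cong-⇔ (announce-cong (¬' θ) (λ B' z' → ¬-cong-⇔ (invariance θ B' z')) B _ _
       (λ z' → satEL-cong B z' ψ[ G ∣ f ] ×-⇔ satEL-cong B z' ψ[ ∁ G ∣ g ]) z))

identity : ∀ {n} (M : Model n) → Bisim M M _≡_
identity M = record
  { atom  = λ { p refl → ⟺-refl }
  ; forth = λ { a w' refl r → w' , r , refl }
  ; back  = λ { a v' refl r → v' , r , refl }
  }

-- Restricting to equivalent subsets gives the same truths; in particular truth in
-- M ↾ D does not depend on the proof that the world lies in D.
reannounce : ∀ {n} (M : Model n) {D D' : W M → Set} → (∀ w → D w ⟺ D' w) →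
             ∀ φ {w d d'} → (M ↾ D) ▸ (w , d) ⊨ φ → (M ↾ D') ▸ (w , d') ⊨ φ
reannounce M DD' φ = to (invariance φ (restrict (identity M) _ _ λ { {w} refl → DD' w }) refl)

nested : ∀ {n} (M : Model n) (D₁ : W M → Set) (D₂ : W (M ↾ D₁) → Set) (D : W M → Set) →
         (∀ w → D w ⟺ Σ (D₁ w) λ d → D₂ (w , d)) →
         Bisim ((M ↾ D₁) ↾ D₂) (M ↾ D) (λ u u' → proj₁ (proj₁ u) ≡ proj₁ u')
nested M D₁ D₂ D DD = record
  { atom  = λ { p refl → ⟺-refl }
  ; forth = λ { a ((w' , d₁) , d₂) refl r → (w' , from (DD w') (d₁ , d₂)) , r , refl }
  ; back  = λ { a (w' , d) refl r → ((w' , proj₁ (to (DD w') d)) , proj₂ (to (DD w') d)) , r , refl }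
  }

satEL-⌜⌝ : ∀ {n} (M : Model n) w (e : ELForm n) → satEL M w e ⟺ (M ▸ w ⊨ ⌜ e ⌝)
satEL-⌜⌝ M w (var p)   = ⟺-refl
satEL-⌜⌝ M w (¬' e)    = ¬-cong-⇔ (satEL-⌜⌝ M w e)
satEL-⌜⌝ M w (e ∧' e') = satEL-⌜⌝ M w e ×-⇔ satEL-⌜⌝ M w e'
satEL-⌜⌝ M w (K a e)   = Π-⟺ λ v → →-cong-⇔ ⟺-refl (satEL-⌜⌝ M v e)

data Rule (n : ℕ) : Set where
  rule5 : Subset n → Form n → Form n → Rule n
  rule6 : Subset n → Form n → Rule n

module _ {n : ℕ} where

  conclusion : Rule n → Form n
  conclusion (rule5 G χ θ) = [ G ∣ χ ] θ
  conclusion (rule6 G θ)   = [⟨ G ⟩] θ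

  premise : Rule n → (Fin n → ELForm n) → Form n
  premise (rule5 G χ θ) f = χ ∧' ([ ⌜ ψ[ G ∣ f ] ⌝ ∧' χ ] θ)
  premise (rule6 G θ)   f = ⟨ ∁ G ∣ ⌜ ψ[ G ∣ f ] ⌝ ⟩ θ

  infinitary : ∀ η r → (∀ f → ⊢ (η ⟪ premise r f ⟫)) → ⊢ (η ⟪ conclusion r ⟫)
  infinitary η (rule5 G χ θ) = R5 η G χ θ
  infinitary η (rule6 G θ)   = R6 η G θ

  conclusion⇒premise : ∀ r f → ⊢ (conclusion r ⇒ premise r f)
  conclusion⇒premise (rule5 G χ θ) f = A10 G χ θ f
  conclusion⇒premise (rule6 G θ)   f = A11 G θ f

  -- All ways of reading a formula as η⟪conclusion r⟫ (complete by splits-complete).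
  -- The Lindenbaum construction must provide a witness for each of them.
  splits : Form n → List (NecForm n × Rule n)
  splits ([ G ∣ χ ] θ)      = (♯ , rule5 G χ θ) ∷ []
  splits ([⟨ G ⟩] θ)        = (♯ , rule6 G θ) ∷ []
  splits (¬' (a ∧' (¬' b))) = map (λ (η , r) → imp a η , r) (splits b)
  splits (K a b)            = map (λ (η , r) → Kη a η , r) (splits b)
  splits ([ a ] b)          = map (λ (η , r) → annη a η , r) (splits b)
  splits _                  = []

  splits-complete : ∀ η r → (η , r) ∈ splits (η ⟪ conclusion r ⟫)
  splits-complete ♯ (rule5 G χ θ) = here refl
  splits-complete ♯ (rule6 G θ)   = here refl
  splits-complete (imp a η) r     = ∈-map⁺ (λ (η , r) → imp a η , r) (splits-complete η r)
  splits-complete (Kη a η) r      = ∈-map⁺ (λ (η , r) → Kη a η , r) (splits-complete η r)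
  splits-complete (annη a η) r    = ∈-map⁺ (λ (η , r) → annη a η , r) (splits-complete η r)

-- The reduction axioms A5–A9 and the rules R5/R6 (with A10/A11) are sound as
-- equivalences; the truth lemma reads them from right to left.
module Semantics (lem : ExcludedMiddle 0ℓ) {n : ℕ} (M : Model n) where
  private
    dne : {A : Set} → ¬ ¬ A → A
    dne = em⇒dne lem

    ⟦_⟧ : Form n → W M → Set
    ⟦ ψ ⟧ v = M ▸ v ⊨ ψ

  ⊨A5 : ∀ w ψ p → (M ▸ w ⊨ [ ψ ] var p) ⟺ (M ▸ w ⊨ ψ ⇒ var p)
  ⊨A5 w ψ p = mk⇔ (λ H (h , ¬v) → ¬v (H h)) (λ H h → dne λ ¬v → H (h , ¬v))

  ⊨A6 : ∀ w ψ χ → (M ▸ w ⊨ [ ψ ] (¬' χ)) ⟺ (M ▸ w ⊨ ψ ⇒ ¬' ([ ψ ] χ))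
  ⊨A6 w ψ χ = mk⇔ (λ H (h , ¬¬χ) → ¬¬χ λ G → H h (G h))
                  (λ H h c → H (h , λ ¬χ → ¬χ λ h' → reannounce M (λ _ → ⟺-refl) χ c))

  ⊨A7 : ∀ w ψ a b → (M ▸ w ⊨ [ ψ ] (a ∧' b)) ⟺ (M ▸ w ⊨ ([ ψ ] a) ∧' ([ ψ ] b))
  ⊨A7 w ψ a b = mk⇔ (λ H → (λ h → proj₁ (H h)) , (λ h → proj₂ (H h))) (λ (Ha , Hb) h → Ha h , Hb h)

  ⊨A8 : ∀ w ψ a χ → (M ▸ w ⊨ [ ψ ] K a χ) ⟺ (M ▸ w ⊨ ψ ⇒ K a ([ ψ ] χ))
  ⊨A8 w ψ a χ = mk⇔ (λ H (h , ¬K) → ¬K λ v r k → H h (v , k) r)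
                    (λ H h (v , k) r → dne λ ¬χ → H (h , λ F → ¬χ (F v r k)))

  ⊨A9 : ∀ w ψ χ θ → (M ▸ w ⊨ [ ψ ] ([ χ ] θ)) ⟺ (M ▸ w ⊨ [ ψ ∧' ([ ψ ] χ) ] θ)
  ⊨A9 w ψ χ θ = mk⇔ (λ H (h , k) → to (invariance θ B refl) (H h (k h)))
                    (λ H h k → from (invariance θ B refl) (H (h , λ h' → reannounce M (λ _ → ⟺-refl) χ k)))
    where
    D₂ : W (M ↾ ⟦ ψ ⟧) → Set
    D₂ u = (M ↾ ⟦ ψ ⟧) ▸ u ⊨ χ
    B : Bisim ((M ↾ ⟦ ψ ⟧) ↾ D₂) (M ↾ ⟦ ψ ∧' ([ ψ ] χ) ⟧) (λ u u' → proj₁ (proj₁ u) ≡ proj₁ u')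
    B = nested M ⟦ ψ ⟧ D₂ ⟦ ψ ∧' ([ ψ ] χ) ⟧ λ v →
          mk⇔ (λ (h , k) → h , k h) (λ (h , k) → h , λ h' → reannounce M (λ _ → ⟺-refl) χ k)

  ⊨-conclusion : ∀ w r → (M ▸ w ⊨ conclusion r) ⟺ (∀ f → M ▸ w ⊨ premise r f)
  ⊨-conclusion w (rule5 G χ θ) = mk⇔
    (λ (c , H) f → c , λ d → reannounce M (Dᶠ f) θ (H f (from (Dᶠ f w) d)))
    (λ H → proj₁ (H (λ _ → ⊤EL)) ,
           λ f d → reannounce M (λ v → ⟺-sym (Dᶠ f v)) θ (proj₂ (H f) (to (Dᶠ f w) d)))
    where
    Dᶠ : ∀ f v → (satEL M v ψ[ G ∣ f ] × ⟦ χ ⟧ v) ⟺ ⟦ ⌜ ψ[ G ∣ f ] ⌝ ∧' χ ⟧ v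
    Dᶠ f v = satEL-⌜⌝ M v ψ[ G ∣ f ] ×-⇔ ⟺-refl
  ⊨-conclusion w (rule6 G θ) = mk⇔ fwd bwd
    where
    Dᶠᵍ : ∀ f g v → (satEL M v ψ[ G ∣ f ] × satEL M v ψ[ ∁ G ∣ g ]) ⟺
                    (satEL M v ψ[ ∁ G ∣ g ] × ⟦ ⌜ ψ[ G ∣ f ] ⌝ ⟧ v)
    Dᶠᵍ f g v = mk⇔ (λ (s , t) → t , to (satEL-⌜⌝ M v ψ[ G ∣ f ]) s)
                    (λ (t , s) → from (satEL-⌜⌝ M v ψ[ G ∣ f ]) s , t)
    fwd : M ▸ w ⊨ [⟨ G ⟩] θ → ∀ f → M ▸ w ⊨ ⟨ ∁ G ∣ ⌜ ψ[ G ∣ f ] ⌝ ⟩ θ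
    fwd H f (s , noG) = let (g , Hg) = H f in
      Hg (from (satEL-⌜⌝ M w ψ[ G ∣ f ]) s) λ d c →
        noG g (to (Dᶠᵍ f g w) d) (reannounce M (Dᶠᵍ f g) θ c)
    -- Classically, a witness g exists unless every g fails; if ψ_G fails at w any g will do.
    bwd : (∀ f → M ▸ w ⊨ ⟨ ∁ G ∣ ⌜ ψ[ G ∣ f ] ⌝ ⟩ θ) → M ▸ w ⊨ [⟨ G ⟩] θ
    bwd H f = dne λ noG →
      let s = dne λ ¬s → noG ((λ _ → ⊤EL) , λ s → ⊥-elim (¬s s)) in
      H f (to (satEL-⌜⌝ M w ψ[ G ∣ f ]) s , λ g d c →
        noG (g , λ _ A → A (from (Dᶠᵍ f g w) d) (reannounce M (λ v → ⟺-sym (Dᶠᵍ f g v)) θ c)))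

⊨-announced-conclusion : ExcludedMiddle 0ℓ → ∀ {n} (M : Model n) w ψ r →
                         (M ▸ w ⊨ [ ψ ] conclusion r) ⟺ (∀ f → M ▸ w ⊨ [ ψ ] premise r f)
⊨-announced-conclusion lem {n} M w ψ r = mk⇔
  (λ H f h → to (inside h) (H h) f)
  (λ H h → from (inside h) (λ f → H f h))
  where
  Mψ : Model n
  Mψ = M ↾ (λ v → M ▸ v ⊨ ψ)
  inside : (h : M ▸ w ⊨ ψ) → (Mψ ▸ (w , h) ⊨ conclusion r) ⟺ (∀ f → Mψ ▸ (w , h) ⊨ premise r f)
  inside h = Semantics.⊨-conclusion lem Mψ (w , h) r

-- Every propositional step of the proof is an instance of a tautological schema
-- over finitely many metavariables; validity of a schema is decided by evaluating
-- it under all assignments, and its instances are theorems by A0.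

infixr 6 _‵∧_
infixr 5 _‵⇒_

data Schema (k : ℕ) : Set where
  ‵_   : Fin k → Schema k
  ‵¬_  : Schema k → Schema k
  _‵∧_ : Schema k → Schema k → Schema k

_‵⇒_ : ∀ {k} → Schema k → Schema k → Schema k
s ‵⇒ t = ‵¬ (s ‵∧ ‵¬ t)

eval : ∀ {k} → Vec Bool k → Schema k → Bool
eval ρ (‵ i)    = lookup ρ i
eval ρ (‵¬ s)   = not (eval ρ s)
eval ρ (s ‵∧ t) = eval ρ s ∧ eval ρ t

every : ∀ k → (Vec Bool k → Bool) → Bool
every zero    P = P []
every (suc k) P = every k (λ ρ → P (true ∷ ρ)) ∧ every k (λ ρ → P (false ∷ ρ))

every-sound : ∀ {k} (P : Vec Bool k → Bool) → T (every k P) → ∀ ρ → T (P ρ)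
every-sound P ok []          = ok
every-sound P ok (true ∷ ρ)  = every-sound (λ ρ → P (true ∷ ρ)) (proj₁ (to T-∧ ok)) ρ
every-sound P ok (false ∷ ρ) = every-sound (λ ρ → P (false ∷ ρ)) (proj₂ (to T-∧ ok)) ρ

module _ {n : ℕ} where

  instantiate : ∀ {k} → Vec (Form n) k → Schema k → Form n
  instantiate σ (‵ i)    = lookup σ i
  instantiate σ (‵¬ s)   = ¬' instantiate σ s
  instantiate σ (s ‵∧ t) = instantiate σ s ∧' instantiate σ t

  evalB-instantiate : ∀ {k} v (σ : Vec (Form n) k) s →
                      evalB v (instantiate σ s) ≡ eval (Vec.map (evalB v) σ) s
  evalB-instantiate v σ (‵ i)    = sym (lookup-map i (evalB v) σ)
  evalB-instantiate v σ (‵¬ s)   = cong not (evalB-instantiate v σ s)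
  evalB-instantiate v σ (s ‵∧ t) = cong₂ _∧_ (evalB-instantiate v σ s) (evalB-instantiate v σ t)

  tautology : ∀ {k} (s : Schema k) → T (every k (λ ρ → eval ρ s)) →
              (σ : Vec (Form n) k) → ⊢ instantiate σ s
  tautology s ok σ = A0 λ v →
    trans (evalB-instantiate v σ s) (to T-≡ (every-sound (λ ρ → eval ρ s) ok (Vec.map (evalB v) σ)))

  private
    p : ∀ {k} → Schema (suc k)
    p = ‵ #0
    q : ∀ {k} → Schema (suc (suc k))
    q = ‵ 1+ #0
    r : ∀ {k} → Schema (suc (suc (suc k)))
    r = ‵ 1+ (1+ #0)

  ∧-elimˡ : ∀ (a b : Form n) → ⊢ (a ∧' b ⇒ a)
  ∧-elimˡ a b = tautology (p ‵∧ q ‵⇒ p) _ (a ∷ b ∷ [])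

  ∧-elimʳ : ∀ (a b : Form n) → ⊢ (a ∧' b ⇒ b)
  ∧-elimʳ a b = tautology (p ‵∧ q ‵⇒ q) _ (a ∷ b ∷ [])

  ∧-intro : ∀ (a b : Form n) → ⊢ (a ⇒ b ⇒ a ∧' b)
  ∧-intro a b = tautology (p ‵⇒ q ‵⇒ p ‵∧ q) _ (a ∷ b ∷ [])

  ⇒-refl : ∀ (a : Form n) → ⊢ (a ⇒ a)
  ⇒-refl a = tautology (p ‵⇒ p) _ (a ∷ [])

  ⇒-weaken : ∀ (a b : Form n) → ⊢ (a ⇒ b ⇒ a)
  ⇒-weaken a b = tautology (p ‵⇒ q ‵⇒ p) _ (a ∷ b ∷ [])

  ⇒-trans : ∀ (a b c : Form n) → ⊢ ((a ⇒ b) ⇒ (b ⇒ c) ⇒ (a ⇒ c))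
  ⇒-trans a b c = tautology ((p ‵⇒ q) ‵⇒ (q ‵⇒ r) ‵⇒ (p ‵⇒ r)) _ (a ∷ b ∷ c ∷ [])

  ⇒-distrib : ∀ (a b c : Form n) → ⊢ ((a ⇒ b ⇒ c) ⇒ (a ⇒ b) ⇒ (a ⇒ c))
  ⇒-distrib a b c = tautology ((p ‵⇒ q ‵⇒ r) ‵⇒ (p ‵⇒ q) ‵⇒ (p ‵⇒ r)) _ (a ∷ b ∷ c ∷ [])

  ¬-intro : ∀ (a b : Form n) → ⊢ ((a ⇒ ¬' b) ⇒ (a ⇒ b) ⇒ ¬' a)
  ¬-intro a b = tautology ((p ‵⇒ ‵¬ q) ‵⇒ (p ‵⇒ q) ‵⇒ ‵¬ p) _ (a ∷ b ∷ [])

  ¬-cases : ∀ (a b : Form n) → ⊢ (¬' (a ∧' b) ⇒ ¬' (a ∧' ¬' b) ⇒ ¬' a)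
  ¬-cases a b = tautology (‵¬ (p ‵∧ q) ‵⇒ ‵¬ (p ‵∧ ‵¬ q) ‵⇒ ‵¬ p) _ (a ∷ b ∷ [])

  ¬¬-elim : ∀ (a : Form n) → ⊢ (¬' ¬' a ⇒ a)
  ¬¬-elim a = tautology (‵¬ ‵¬ p ‵⇒ p) _ (a ∷ [])

record Theory {n} (Γ : Form n → Set) : Set where
  field
    thm    : ∀ {φ} → ⊢ φ → Γ φ
    mp     : ∀ {φ ψ} → Γ (φ ⇒ ψ) → Γ φ → Γ ψ
    closed : ∀ η r → (∀ f → Γ (η ⟪ premise r f ⟫)) → Γ (η ⟪ conclusion r ⟫)

  infer : ∀ {a b} → ⊢ (a ⇒ b) → Γ a → Γ b
  infer ab = mp (thm ab)

  infer₂ : ∀ {a b c} → ⊢ (a ⇒ b ⇒ c) → Γ a → Γ b → Γ c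
  infer₂ abc x y = mp (mp (thm abc) x) y

⊢-theory : ∀ {n} → Theory {n} ⊢_
⊢-theory = record { thm = λ p → p ; mp = R0 ; closed = infinitary }

⇒-chain : ∀ {n} {a b c : Form n} → ⊢ (a ⇒ b) → ⊢ (b ⇒ c) → ⊢ (a ⇒ c)
⇒-chain {a = a} {b} {c} = Theory.infer₂ ⊢-theory (⇒-trans a b c)

record MaximalConsistent {n} (t : Form n → Bool) : Set where
  field
    theory     : Theory (λ φ → T (t φ))
    consistent : ∀ {φ} → T (t φ) → T (t (¬' φ)) → ⊥
    maximal    : ∀ φ → T (t φ) ⊎ T (t (¬' φ))

-- An enumeration of formulas: the Lindenbaum construction visits every formula
-- at some finite stage.

subsets : ∀ n → List (Subset n)
subsets zero    = [] ∷ []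
subsets (suc n) = map (true ∷_) (subsets n) ++ map (false ∷_) (subsets n)

∈-subsets : ∀ {n} (G : Subset n) → G ∈ subsets n
∈-subsets []          = here refl
∈-subsets (true ∷ G)  = ∈-++⁺ˡ (∈-map⁺ (true ∷_) (∈-subsets G))
∈-subsets {suc n} (false ∷ G) = ∈-++⁺ʳ (map (true ∷_) (subsets n)) (∈-map⁺ (false ∷_) (∈-subsets G))

module Enumeration (n : ℕ) where

  stage  : ℕ → List (Form n)
  layers : ℕ → List (List (Form n))

  stage zero    = []
  stage (suc k) = concat (layers k)

  layers k =
      S
    ∷ map var (upTo k)
    ∷ map ¬'_ S
    ∷ cartesianProductWith _∧'_ S S
    ∷ cartesianProductWith K (allFin n) S
    ∷ cartesianProductWith [_]_ S S
    ∷ cartesianProductWith (λ (G , χ) θ → [ G ∣ χ ] θ) (cartesianProduct (subsets n) S) S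
    ∷ cartesianProductWith [⟨_⟩]_ (subsets n) S
    ∷ []
    where
    S : List (Form n)
    S = stage k

  enter : ∀ {φ} k → Any (φ ∈_) (layers k) → φ ∈ stage (suc k)
  enter k = ∈-concat⁺

  stage-mono : ∀ {φ i j} → i ≤ j → φ ∈ stage i → φ ∈ stage j
  stage-mono i≤j = go (≤⇒≤′ i≤j)
    where
    go : ∀ {φ i j} → i ≤′ j → φ ∈ stage i → φ ∈ stage j
    go (≤′-reflexive refl)          φ∈ = φ∈
    go (≤′-step {j} i≤′j) φ∈ = enter j (here (go i≤′j φ∈))

  enumerated : ∀ φ → Σ ℕ λ k → φ ∈ stage k
  both : ∀ φ ψ → Σ ℕ λ k → φ ∈ stage k × ψ ∈ stage k

  enumerated (var p) =
    suc (suc p) , enter (suc p) (there (here (∈-map⁺ var (∈-upTo⁺ ≤-refl))))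
  enumerated (¬' φ) =
    let (k , φ∈) = enumerated φ in
    suc k , enter k (there (there (here (∈-map⁺ ¬'_ φ∈))))
  enumerated (φ ∧' ψ) =
    let (k , φ∈ , ψ∈) = both φ ψ in
    suc k , enter k (there (there (there (here (∈-cartesianProductWith⁺ _∧'_ φ∈ ψ∈)))))
  enumerated (K a φ) =
    let (k , φ∈) = enumerated φ in
    suc k , enter k (there (there (there (there (here (∈-cartesianProductWith⁺ K (∈-allFin a) φ∈))))))
  enumerated ([ φ ] ψ) =
    let (k , φ∈ , ψ∈) = both φ ψ in
    suc k , enter k (there (there (there (there (there (here (∈-cartesianProductWith⁺ [_]_ φ∈ ψ∈)))))))
  enumerated ([ G ∣ χ ] θ) =
    let (k , χ∈ , θ∈) = both χ θ in
    suc k , enter k (there (there (there (there (there (there (here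
      (∈-cartesianProductWith⁺ (λ (G , χ) θ → [ G ∣ χ ] θ)
         (∈-cartesianProduct⁺ (∈-subsets G) χ∈) θ∈))))))))
  enumerated ([⟨ G ⟩] θ) =
    let (k , θ∈) = enumerated θ in
    suc k , enter k (there (there (there (there (there (there (there (here
      (∈-cartesianProductWith⁺ [⟨_⟩]_ (∈-subsets G) θ∈)))))))))

  both φ ψ =
    let (i , φ∈) = enumerated φ ; (j , ψ∈) = enumerated ψ in
    i ⊔ j , stage-mono (m≤m⊔n i j) φ∈ , stage-mono (m≤n⊔m i j) ψ∈

record Extension {n} (Γ : Form n → Set) (δ : Form n) : Set where
  field
    set        : Form n → Bool
    mcs        : MaximalConsistent set
    includes   : ∀ {φ} → Γ φ → T (set φ)
    contains-δ : T (set δ)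

-- The Lindenbaum lemma for a theory Γ: a formula δ₀ consistent with Γ is
-- strengthened along the enumeration to a chain of consistent formulas that
-- settles every formula; whenever a formula η⟪conclusion r⟫ is refuted, a refuted
-- premise η⟪premise r f⟫ is added (possible since Γ is closed under the rule).
-- The theory of the chain is the required maximal consistent extension.
module Lindenbaum (lem : ExcludedMiddle 0ℓ) {n : ℕ} {Γ : Form n → Set} (Γ-theory : Theory Γ) where
  open Theory Γ-theory
  open Enumeration n

  private
    dne : {A : Set} → ¬ ¬ A → A
    dne = em⇒dne lem

  Consistent : Form n → Set
  Consistent δ = ¬ Γ (¬' δ)

  Witness : Form n → NecForm n → Rule n → Set
  Witness δ η r = Σ (Fin n → ELForm n) λ f → Consistent (δ ∧' ¬' (η ⟪ premise r f ⟫))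

  addWitness : ∀ δ η r → Dec (Witness δ η r) → Form n
  addWitness δ η r (yes (f , _)) = δ ∧' ¬' (η ⟪ premise r f ⟫)
  addWitness δ η r (no _)        = δ

  addWitness-consistent : ∀ {δ η r} w? → Consistent δ → Consistent (addWitness δ η r w?)
  addWitness-consistent (yes (_ , c)) _ = c
  addWitness-consistent (no _)        c = c

  addWitness-⇒ : ∀ {δ η r} w? → ⊢ (addWitness δ η r w? ⇒ δ)
  addWitness-⇒ (yes _)    = ∧-elimˡ _ _
  addWitness-⇒ {δ} (no _) = ⇒-refl δ

  -- If δ refutes η⟪conclusion r⟫, a premise is refuted after adding a witness: with
  -- no witness, Γ proves δ ⇒ η⟪premise r f⟫ for all f, hence δ ⇒ η⟪conclusion r⟫
  -- by the rule in the necessity form δ ⇒ η, making δ inconsistent.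
  addWitness-refutes : ∀ {δ η r} w? → Consistent δ → ⊢ (δ ⇒ ¬' (η ⟪ conclusion r ⟫)) →
                       Σ (Fin n → ELForm n) λ f → ⊢ (addWitness δ η r w? ⇒ ¬' (η ⟪ premise r f ⟫))
  addWitness-refutes (yes (f , _)) _ _ = f , ∧-elimʳ _ _
  addWitness-refutes {δ} {η} {r} (no ∄w) c refutes = ⊥-elim (c ¬δ)
    where
    ¬δ : Γ (¬' δ)
    ¬δ = infer₂ (¬-intro δ (η ⟪ conclusion r ⟫)) (thm refutes)
                (closed (imp δ η) r λ f → dne λ ¬T → ∄w (f , ¬T))

  addWitnesses : Form n → List (NecForm n × Rule n) → Form n
  addWitnesses δ []             = δ
  addWitnesses δ ((η , r) ∷ ds) = addWitnesses (addWitness δ η r lem) ds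

  addWitnesses-consistent : ∀ {δ} ds → Consistent δ → Consistent (addWitnesses δ ds)
  addWitnesses-consistent []      c = c
  addWitnesses-consistent (_ ∷ ds) c = addWitnesses-consistent ds (addWitness-consistent lem c)

  addWitnesses-⇒ : ∀ {δ} ds → ⊢ (addWitnesses δ ds ⇒ δ)
  addWitnesses-⇒ {δ} []   = ⇒-refl δ
  addWitnesses-⇒ (_ ∷ ds) = ⇒-chain (addWitnesses-⇒ ds) (addWitness-⇒ lem)

  addWitnesses-refutes : ∀ {δ η r} ds → (η , r) ∈ ds → Consistent δ →
                         ⊢ (δ ⇒ ¬' (η ⟪ conclusion r ⟫)) →
                         Σ (Fin n → ELForm n) λ f → ⊢ (addWitnesses δ ds ⇒ ¬' (η ⟪ premise r f ⟫))
  addWitnesses-refutes (_ ∷ ds) (here refl) c refutes =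
    let (f , p) = addWitness-refutes lem c refutes in f , ⇒-chain (addWitnesses-⇒ ds) p
  addWitnesses-refutes (_ ∷ ds) (there d∈) c refutes =
    addWitnesses-refutes ds d∈ (addWitness-consistent lem c) (⇒-chain (addWitness-⇒ lem) refutes)

  Settles : Form n → Form n → Set
  Settles δ φ = ⊢ (δ ⇒ φ) ⊎ (⊢ (δ ⇒ ¬' φ) × (∀ η r → η ⟪ conclusion r ⟫ ≡ φ →
                  Σ (Fin n → ELForm n) λ f → ⊢ (δ ⇒ ¬' (η ⟪ premise r f ⟫))))

  settles-weaken : ∀ {δ δ' φ} → ⊢ (δ' ⇒ δ) → Settles δ φ → Settles δ' φ
  settles-weaken δ'⇒δ (inj₁ p) = inj₁ (⇒-chain δ'⇒δ p)
  settles-weaken δ'⇒δ (inj₂ (p , wit)) =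
    inj₂ (⇒-chain δ'⇒δ p , λ η r eq → let (f , q) = wit η r eq in f , ⇒-chain δ'⇒δ q)

  settle : ∀ δ φ → Dec (Consistent (δ ∧' φ)) → Form n
  settle δ φ (yes _) = δ ∧' φ
  settle δ φ (no _)  = addWitnesses (δ ∧' ¬' φ) (splits φ)

  consistent-¬ : ∀ {δ φ} → Consistent δ → ¬ Consistent (δ ∧' φ) → Consistent (δ ∧' ¬' φ)
  consistent-¬ {δ} {φ} c ¬c T¬δ¬φ = c (infer₂ (¬-cases δ φ) (dne ¬c) T¬δ¬φ)

  settle-consistent : ∀ {δ φ} c? → Consistent δ → Consistent (settle δ φ c?)
  settle-consistent (yes c)        _ = c
  settle-consistent {φ = φ} (no ¬c) c = addWitnesses-consistent (splits φ) (consistent-¬ c ¬c)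

  settle-⇒ : ∀ {δ φ} c? → ⊢ (settle δ φ c? ⇒ δ)
  settle-⇒ (yes _)          = ∧-elimˡ _ _
  settle-⇒ {φ = φ} (no _)   = ⇒-chain (addWitnesses-⇒ (splits φ)) (∧-elimˡ _ _)

  settle-settles : ∀ {δ φ} c? → Consistent δ → Settles (settle δ φ c?) φ
  settle-settles (yes _)          _ = inj₁ (∧-elimʳ _ _)
  settle-settles {δ} {φ} (no ¬c) c = inj₂ (⇒-chain (addWitnesses-⇒ (splits φ)) (∧-elimʳ _ _) , wit)
    where
    wit : ∀ η r → η ⟪ conclusion r ⟫ ≡ φ → Σ (Fin n → ELForm n) λ f →
          ⊢ (addWitnesses (δ ∧' ¬' φ) (splits φ) ⇒ ¬' (η ⟪ premise r f ⟫))
    wit η r refl = addWitnesses-refutes (splits (η ⟪ conclusion r ⟫)) (splits-complete η r)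
                     (consistent-¬ c ¬c) (∧-elimʳ δ (¬' (η ⟪ conclusion r ⟫)))

  settleAll : Form n → List (Form n) → Form n
  settleAll δ []       = δ
  settleAll δ (φ ∷ φs) = settleAll (settle δ φ lem) φs

  settleAll-consistent : ∀ {δ} φs → Consistent δ → Consistent (settleAll δ φs)
  settleAll-consistent []       c = c
  settleAll-consistent (_ ∷ φs) c = settleAll-consistent φs (settle-consistent lem c)

  settleAll-⇒ : ∀ {δ} φs → ⊢ (settleAll δ φs ⇒ δ)
  settleAll-⇒ {δ} []   = ⇒-refl δ
  settleAll-⇒ (_ ∷ φs) = ⇒-chain (settleAll-⇒ φs) (settle-⇒ lem)

  settleAll-settles : ∀ {δ φ} φs → φ ∈ φs → Consistent δ → Settles (settleAll δ φs) φ
  settleAll-settles (_ ∷ φs) (here refl) c = settles-weaken (settleAll-⇒ φs) (settle-settles lem c)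
  settleAll-settles (_ ∷ φs) (there φ∈)  c = settleAll-settles φs φ∈ (settle-consistent lem c)

  module Construction (δ₀ : Form n) (c₀ : Consistent δ₀) where

    chain : ℕ → Form n
    chain zero    = δ₀
    chain (suc m) = settleAll (chain m) (stage m)

    chain-consistent : ∀ m → Consistent (chain m)
    chain-consistent zero    = c₀
    chain-consistent (suc m) = settleAll-consistent (stage m) (chain-consistent m)

    chain-⇒ : ∀ {i j} → i ≤ j → ⊢ (chain j ⇒ chain i)
    chain-⇒ i≤j = go (≤⇒≤′ i≤j)
      where
      go : ∀ {i j} → i ≤′ j → ⊢ (chain j ⇒ chain i)
      go {i} (≤′-reflexive refl) = ⇒-refl (chain i)
      go (≤′-step {j} i≤′j)      = ⇒-chain (settleAll-⇒ (stage j)) (go i≤′j)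

    chain-settles : ∀ φ → Σ ℕ λ m → Settles (chain m) φ
    chain-settles φ = let (k , φ∈) = enumerated φ in
      suc k , settleAll-settles (stage k) φ∈ (chain-consistent k)

    Limit : Form n → Set
    Limit φ = Σ ℕ λ m → Γ (chain m ⇒ φ)

    limit-weaken : ∀ {φ i j} → i ≤ j → Γ (chain i ⇒ φ) → Γ (chain j ⇒ φ)
    limit-weaken {φ} {i} {j} i≤j = infer₂ (⇒-trans (chain j) (chain i) φ) (thm (chain-⇒ i≤j))

    limit-align : ∀ {φ ψ} → Limit φ → Limit ψ → Σ ℕ λ m → Γ (chain m ⇒ φ) × Γ (chain m ⇒ ψ)
    limit-align (i , φ) (j , ψ) = i ⊔ j , limit-weaken (m≤m⊔n i j) φ , limit-weaken (m≤n⊔m i j) ψ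

    limit-⊇ : ∀ {φ} → Γ φ → Limit φ
    limit-⊇ {φ} φ∈ = 0 , infer (⇒-weaken φ δ₀) φ∈

    limit-mp : ∀ {φ ψ} → Limit (φ ⇒ ψ) → Limit φ → Limit ψ
    limit-mp {φ} {ψ} φ⇒ψ φ′ = let (m , p , q) = limit-align φ⇒ψ φ′ in
      m , infer₂ (⇒-distrib (chain m) φ ψ) p q

    limit-consistent : ∀ {φ} → Limit φ → Limit (¬' φ) → ⊥
    limit-consistent {φ} φ′ ¬φ′ = let (m , p , q) = limit-align φ′ ¬φ′ in
      chain-consistent m (infer₂ (¬-intro (chain m) φ) q p)

    limit-maximal : ∀ φ → Limit φ ⊎ Limit (¬' φ)
    limit-maximal φ with chain-settles φ
    ... | m , inj₁ p       = inj₁ (m , thm p)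
    ... | m , inj₂ (p , _) = inj₂ (m , thm p)

    limit-closed : ∀ η r → (∀ f → Limit (η ⟪ premise r f ⟫)) → Limit (η ⟪ conclusion r ⟫)
    limit-closed η r prem with chain-settles (η ⟪ conclusion r ⟫)
    ... | m , inj₁ p         = m , thm p
    ... | m , inj₂ (_ , wit) =
      let (f , p) = wit η r refl in ⊥-elim (limit-consistent (prem f) (m , thm p))

  lindenbaum : ∀ δ₀ → Consistent δ₀ → Extension Γ δ₀
  lindenbaum δ₀ c₀ = record
    { set        = λ φ → isYes (lem {Limit φ})
    ; mcs        = record
      { theory     = record
        { thm    = λ p → fromWitness (limit-⊇ (thm p))
        ; mp     = λ p q → fromWitness (limit-mp (toWitness p) (toWitness q))
        ; closed = λ η r prem → fromWitness (limit-closed η r λ f → toWitness (prem f))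
        }
      ; consistent = λ p q → limit-consistent (toWitness p) (toWitness q)
      ; maximal    = λ φ → Sum.map fromWitness fromWitness (limit-maximal φ)
      }
    ; includes   = λ p → fromWitness (limit-⊇ p)
    ; contains-δ = fromWitness (0 , thm (⇒-refl δ₀))
    }
    where open Construction δ₀ c₀

-- The truth lemma is proved by induction along (depth, size), ordered
-- lexicographically.  The depth counts nested group operators, weighted so that
-- the premises of R5/R6 are shallower than their conclusions (ELForm formulas have
-- depth 0); the size weights the announced formula so that each reduction axiom
-- A5–A9 replaces a formula by a smaller one of no greater depth.

module _ {n : ℕ} where

  depth : Form n → ℕ
  depth (var p)       = 0
  depth (¬' φ)        = depth φ
  depth (φ ∧' ψ)      = depth φ ⊔ depth ψ
  depth (K a φ)       = depth φ
  depth ([ φ ] ψ)     = depth φ + depth ψ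
  depth ([ G ∣ χ ] θ) = suc (depth χ + depth θ)
  depth ([⟨ G ⟩] θ)   = suc (suc (depth θ))

  size : Form n → ℕ
  size (var p)       = 1
  size (¬' φ)        = suc (size φ)
  size (φ ∧' ψ)      = suc (size φ + size ψ)
  size (K a φ)       = suc (size φ)
  size ([ φ ] ψ)     = suc ((5 + size φ) * size ψ)
  size ([ G ∣ χ ] θ) = 1
  size ([⟨ G ⟩] θ)   = 1

  infix 4 _≺_
  data _≺_ (φ ψ : Form n) : Set where
    shallower : depth φ < depth ψ → φ ≺ ψ
    smaller   : depth φ ≡ depth ψ → size φ < size ψ → φ ≺ ψ

  ≺-wellFounded : WellFounded _≺_
  ≺-wellFounded = Subrelation.wellFounded lexicographic
    (On.wellFounded (λ φ → depth φ , size φ) (×-wellFounded <-wellFounded <-wellFounded))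
    where
    lexicographic : ∀ {φ ψ} → φ ≺ ψ → ×-Lex _≡_ _<_ _<_ (depth φ , size φ) (depth ψ , size ψ)
    lexicographic (shallower d) = inj₁ d
    lexicographic (smaller d s) = inj₂ (d , s)

  by-size : ∀ {φ ψ} → depth φ ≤ depth ψ → size φ < size ψ → φ ≺ ψ
  by-size d s with m≤n⇒m<n∨m≡n d
  ... | inj₁ d< = shallower d<
  ... | inj₂ d≡ = smaller d≡ s

  depth-EL : (e : ELForm n) → depth ⌜ e ⌝ ≡ 0
  depth-EL (var p)   = refl
  depth-EL (¬' e)    = depth-EL e
  depth-EL (e ∧' e') rewrite depth-EL e | depth-EL e' = refl
  depth-EL (K a e)   = depth-EL e

  -- Every formula has positive size, so announcing ψ is at least as large as ψ.
  size-nonzero : ∀ φ → NonZero (size φ)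
  size-nonzero (var p)       = _
  size-nonzero (¬' φ)        = _
  size-nonzero (φ ∧' ψ)      = _
  size-nonzero (K a φ)       = _
  size-nonzero ([ φ ] ψ)     = _
  size-nonzero ([ G ∣ χ ] θ) = _
  size-nonzero ([⟨ G ⟩] θ)   = _

  private
    <-by-gap : ∀ {a b} k → a + suc k ≡ b → a < b
    <-by-gap {a} k eq = subst (a <_) eq (m<m+n a (s≤s z≤n))

    depth-EL≤ : ∀ (e : ELForm n) m → depth ⌜ e ⌝ ≤ m
    depth-EL≤ e m rewrite depth-EL e = z≤n

  ≺-¬ : ∀ φ → φ ≺ ¬' φ
  ≺-¬ φ = by-size ≤-refl ≤-refl

  ≺-K : ∀ a φ → φ ≺ K a φ
  ≺-K a φ = by-size ≤-refl ≤-refl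

  ≺-∧ˡ : ∀ φ ψ → φ ≺ (φ ∧' ψ)
  ≺-∧ˡ φ ψ = by-size (m≤m⊔n (depth φ) (depth ψ)) (s≤s (m≤m+n (size φ) (size ψ)))

  ≺-∧ʳ : ∀ φ ψ → ψ ≺ (φ ∧' ψ)
  ≺-∧ʳ φ ψ = by-size (m≤n⊔m (depth φ) (depth ψ)) (s≤s (m≤n+m (size ψ) (size φ)))

  ≺-announced : ∀ ψ θ → ψ ≺ [ ψ ] θ
  ≺-announced ψ θ = by-size (m≤m+n (depth ψ) (depth θ))
    (s≤s (≤-trans (m≤n+m (size ψ) 5) (m≤m*n (5 + size ψ) (size θ) {{size-nonzero θ}})))

  ≺-A5 : ∀ ψ p → (ψ ⇒ var p) ≺ [ ψ ] var p
  ≺-A5 ψ p = by-size (⊔-lub (m≤m+n (depth ψ) 0) z≤n) (<-by-gap 1 (gap (size ψ)))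
    where gap : ∀ s → suc (suc (s + 2)) + 2 ≡ suc ((5 + s) * 1)
          gap = solve-∀

  ≺-A6 : ∀ ψ χ → (ψ ⇒ ¬' ([ ψ ] χ)) ≺ [ ψ ] (¬' χ)
  ≺-A6 ψ χ = by-size (⊔-lub (m≤m+n (depth ψ) (depth χ)) ≤-refl) (<-by-gap 0 (gap (size ψ) (size χ)))
    where gap : ∀ s c → suc (suc (s + suc (suc (suc ((5 + s) * c))))) + 1 ≡ suc ((5 + s) * suc c)
          gap = solve-∀

  ≺-A7 : ∀ ψ a b → (([ ψ ] a) ∧' ([ ψ ] b)) ≺ [ ψ ] (a ∧' b)
  ≺-A7 ψ a b = by-size (⊔-lub (+-monoʳ-≤ (depth ψ) (m≤m⊔n (depth a) (depth b)))
                              (+-monoʳ-≤ (depth ψ) (m≤n⊔m (depth a) (depth b))))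
                       (<-by-gap (2 + size ψ) (gap (size ψ) (size a) (size b)))
    where gap : ∀ s x y → suc (suc ((5 + s) * x) + suc ((5 + s) * y)) + suc (2 + s) ≡ suc ((5 + s) * suc (x + y))
          gap = solve-∀

  ≺-A8 : ∀ ψ a χ → (ψ ⇒ K a ([ ψ ] χ)) ≺ [ ψ ] K a χ
  ≺-A8 ψ a χ = by-size (⊔-lub (m≤m+n (depth ψ) (depth χ)) ≤-refl) (<-by-gap 0 (gap (size ψ) (size χ)))
    where gap : ∀ s c → suc (suc (s + suc (suc (suc ((5 + s) * c))))) + 1 ≡ suc ((5 + s) * suc c)
          gap = solve-∀

  ≺-A9 : ∀ ψ χ θ → [ ψ ∧' ([ ψ ] χ) ] θ ≺ [ ψ ] ([ χ ] θ)
  ≺-A9 ψ χ θ =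
    by-size (subst (depth ψ ⊔ (depth ψ + depth χ) + depth θ ≤_) (+-assoc (depth ψ) (depth χ) (depth θ))
                   (+-monoˡ-≤ (depth θ) (⊔-lub (m≤m+n (depth ψ) (depth χ)) ≤-refl)))
            (<-by-gap (4 + size ψ + (18 + 4 * size ψ) * size θ) (gap (size ψ) (size χ) (size θ)))
    where gap : ∀ s c t → suc ((5 + suc (s + suc ((5 + s) * c))) * t) + suc (4 + s + (18 + 4 * s) * t)
                          ≡ suc ((5 + s) * suc ((5 + c) * t))
          gap = solve-∀

  premise-shallower : ∀ r f → depth (premise r f) < depth (conclusion r)
  premise-shallower (rule5 G χ θ) f =
    s≤s (⊔-lub (m≤m+n (depth χ) (depth θ))
               (+-monoˡ-≤ (depth θ) (⊔-lub (depth-EL≤ ψ[ G ∣ f ] (depth χ)) ≤-refl)))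
  premise-shallower (rule6 G θ) f = s≤s (s≤s (+-monoˡ-≤ (depth θ) (depth-EL≤ ψ[ G ∣ f ] 0)))

  ≺-premise : ∀ r f → premise r f ≺ conclusion r
  ≺-premise r f = shallower (premise-shallower r f)

  ≺-announced-premise : ∀ ψ r f → [ ψ ] premise r f ≺ [ ψ ] conclusion r
  ≺-announced-premise ψ r f = shallower (+-monoʳ-< (depth ψ) (premise-shallower r f))

  ≺-R5-guard : ∀ G χ θ → χ ≺ [ G ∣ χ ] θ
  ≺-R5-guard G χ θ = shallower (s≤s (m≤m+n (depth χ) (depth θ)))

module Canonical (lem : ExcludedMiddle 0ℓ) {n : ℕ} where

  -- Worlds are maximal consistent sets, given by their (Boolean) characteristic
  -- function so that the type of worlds is small.
  World : Set
  World = Σ (Form n → Bool) MaximalConsistent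

  infix 4 _∋_
  _∋_ : World → Form n → Set
  x ∋ φ = T (proj₁ x φ)

  module _ (x : World) where
    open MaximalConsistent (proj₂ x)
    open Theory theory

    ∋-theorem : ∀ {φ} → ⊢ φ → x ∋ φ
    ∋-theorem = thm

    ∋-mp : ∀ {φ ψ} → x ∋ (φ ⇒ ψ) → x ∋ φ → x ∋ ψ
    ∋-mp = mp

    ∋-infer : ∀ {φ ψ} → ⊢ (φ ⇒ ψ) → x ∋ φ → x ∋ ψ
    ∋-infer = infer

    ∋-closed : ∀ η r → (∀ f → x ∋ η ⟪ premise r f ⟫) → x ∋ η ⟪ conclusion r ⟫
    ∋-closed = closed

    ∋-stable : ∀ {φ} → ¬ ¬ x ∋ φ → x ∋ φ
    ∋-stable = decidable-stable (T? _)

    ∋-¬ : ∀ {φ} → (x ∋ ¬' φ) ⟺ (¬ x ∋ φ)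
    ∋-¬ {φ} = mk⇔ (λ x∋¬φ x∋φ → consistent x∋φ x∋¬φ)
                  (λ ∌φ → Sum.[ (λ x∋φ → ⊥-elim (∌φ x∋φ)) , (λ x∋¬φ → x∋¬φ) ]′ (maximal φ))

    ∋-∧ : ∀ {φ ψ} → (x ∋ φ ∧' ψ) ⟺ ((x ∋ φ) × (x ∋ ψ))
    ∋-∧ {φ} {ψ} = mk⇔ (λ φψ → infer (∧-elimˡ φ ψ) φψ , infer (∧-elimʳ φ ψ) φψ)
                      (λ (φ′ , ψ′) → infer₂ (∧-intro φ ψ) φ′ ψ′)

    ∋-⇔ : ∀ {φ ψ} → ⊢ (φ ⇔ ψ) → (x ∋ φ) ⟺ (x ∋ ψ)
    ∋-⇔ {φ} {ψ} φ⇔ψ = let (φ⇒ψ , ψ⇒φ) = to ∋-∧ (thm φ⇔ψ) in mk⇔ (mp φ⇒ψ) (mp ψ⇒φ)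

    -- Modus ponens under a true announcement, from A6 and A7.
    ∋-announced-mp : ∀ {ψ φ χ} → x ∋ ψ → x ∋ [ ψ ] (φ ⇒ χ) → x ∋ [ ψ ] φ → x ∋ [ ψ ] χ
    ∋-announced-mp {ψ} {φ} {χ} x∋ψ x∋φ⇒χ x∋φ = ∋-stable λ ∌χ →
      to ∋-¬ ¬both (from ∋-∧ (x∋φ , from (∋-⇔ (A6 ψ χ)) (infer (⇒-weaken _ ψ) (from ∋-¬ ∌χ))))
      where
      ¬both : x ∋ ¬' (([ ψ ] φ) ∧' ([ ψ ] (¬' χ)))
      ¬both = from ∋-¬ λ both → to ∋-¬ (mp (to (∋-⇔ (A6 ψ (φ ∧' ¬' χ))) x∋φ⇒χ) x∋ψ)
                                       (from (∋-⇔ (A7 ψ φ (¬' χ))) both)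

  Rᶜ : Fin n → World → World → Set
  Rᶜ a x y = ∀ φ → x ∋ K a φ → y ∋ φ

  Rᶜ-equivalence : ∀ a → IsEquivalence (Rᶜ a)
  Rᶜ-equivalence a = record
    { refl  = λ {x} φ Kφ → ∋-infer x (A2 a φ) Kφ
    ; sym   = λ {x} {y} → Rᶜ-sym {x} {y}
    ; trans = λ {x} xy yz φ Kφ → yz φ (xy (K a φ) (∋-infer x (A3 a φ) Kφ))
    }
    where
    -- If K_a φ ∈ y but φ ∉ x, then K_a φ ∉ x (A2), so K_a ¬K_a φ ∈ x (A4) and ¬K_a φ ∈ y.
    Rᶜ-sym : ∀ {x y} → Rᶜ a x y → Rᶜ a y x
    Rᶜ-sym {x} {y} xy φ y∋Kφ = ∋-stable x λ ∌φ →
      let ∌Kφ : ¬ x ∋ K a φ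
          ∌Kφ x∋Kφ = ∌φ (∋-infer x (A2 a φ) x∋Kφ)
      in to (∋-¬ y) (xy (¬' K a φ) (∋-infer x (A4 a φ) (from (∋-¬ x) ∌Kφ))) y∋Kφ

  Mᶜ : Model n
  Mᶜ = record { W = World ; R = Rᶜ ; equiv = Rᶜ-equivalence ; V = λ p x → x ∋ var p }

  -- The sets {ψ | K_a ψ ∈ x} form a theory (R1, A1, R5/R6 in the form K_a η),
  -- consistent with ¬φ, and its Lindenbaum extension is the required world.
  K-witness : ∀ x a φ → ¬ x ∋ K a φ → Σ World λ y → Rᶜ a x y × ¬ y ∋ φ
  K-witness x a φ ∌Kφ = y , (λ ψ → includes) , to (∋-¬ y) contains-δ
    where
    Known : Form n → Set
    Known ψ = x ∋ K a ψ
    known-theory : Theory Known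
    known-theory = record
      { thm    = λ ⊢ψ → ∋-theorem x (R1 a ⊢ψ)
      ; mp     = λ ψ⇒χ ψ′ → ∋-mp x (∋-mp x (∋-theorem x (A1 a _ _)) ψ⇒χ) ψ′
      ; closed = λ η → ∋-closed x (Kη a η)
      }
    open Lindenbaum lem known-theory using (lindenbaum)
    consistent : ¬ Known (¬' ¬' φ)
    consistent K¬¬φ =
      ∌Kφ (∋-mp x (∋-mp x (∋-theorem x (A1 a _ φ)) (∋-theorem x (R1 a (¬¬-elim φ)))) K¬¬φ)
    open Extension (lindenbaum (¬' φ) consistent)
    y : World
    y = set , mcs

  ∋-K : ∀ x a φ → (x ∋ K a φ) ⟺ (∀ y → Rᶜ a x y → y ∋ φ)
  ∋-K x a φ = mk⇔ (λ Kφ y xy → xy φ Kφ)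
    (λ all → ∋-stable x λ ∌Kφ → let (y , xy , ∌φ) = K-witness x a φ ∌Kφ in ∌φ (all y xy))

  open Semantics lem Mᶜ using (⊨A5; ⊨A6; ⊨A7; ⊨A8; ⊨A9; ⊨-conclusion)

  Truth : Form n → Set
  Truth φ = ∀ x → (x ∋ φ) ⟺ (Mᶜ ▸ x ⊨ φ)

  truth-reduce : ∀ {φ φ'} → ⊢ (φ ⇔ φ') → (∀ x → (Mᶜ ▸ x ⊨ φ) ⟺ (Mᶜ ▸ x ⊨ φ')) →
                 Truth φ' → Truth φ
  truth-reduce ax sem t x = ⟺-trans (∋-⇔ x ax) (⟺-trans (t x) (⟺-sym (sem x)))

  truth-conclusion : ∀ r → (∀ f → Truth (premise r f)) → Truth (conclusion r)
  truth-conclusion r t x = ⟺-trans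
    (mk⇔ (λ c f → ∋-infer x (conclusion⇒premise r f) c) (∋-closed x ♯ r))
    (⟺-trans (Π-⟺ λ f → t f x) (⟺-sym (⊨-conclusion x r)))

  -- The same inside an announcement [ψ]; when ψ ∉ x the premises hold vacuously,
  -- which is seen through the truth lemma for ψ and for [ψ] premise.
  truth-announced-conclusion : ∀ ψ r → Truth ψ → (∀ f → Truth ([ ψ ] premise r f)) →
                               Truth ([ ψ ] conclusion r)
  truth-announced-conclusion ψ r tψ t x = ⟺-trans
    (mk⇔ (λ c f → premise-of c f) (∋-closed x (annη ψ ♯) r))
    (⟺-trans (Π-⟺ λ f → t f x) (⟺-sym (⊨-announced-conclusion lem Mᶜ x ψ r)))
    where
    premise-of : x ∋ [ ψ ] conclusion r → ∀ f → x ∋ [ ψ ] premise r f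
    premise-of c f with T? (proj₁ x ψ)
    ... | yes x∋ψ = ∋-announced-mp x x∋ψ (∋-theorem x (R2 ψ (conclusion⇒premise r f))) c
    ... | no  ∌ψ  = from (t f x) λ ⊨ψ → ⊥-elim (∌ψ (from (tψ x) ⊨ψ))

  truth-step : ∀ φ → (∀ {ψ} → ψ ≺ φ → Truth ψ) → Truth φ
  truth-step (var p) ih x = ⟺-refl
  truth-step (¬' φ) ih x = ⟺-trans (∋-¬ x) (¬-cong-⇔ (ih (≺-¬ φ) x))
  truth-step (φ ∧' ψ) ih x = ⟺-trans (∋-∧ x) (ih (≺-∧ˡ φ ψ) x ×-⇔ ih (≺-∧ʳ φ ψ) x)
  truth-step (K a φ) ih x = ⟺-trans (∋-K x a φ) (Π-⟺ λ y → →-cong-⇔ ⟺-refl (ih (≺-K a φ) y))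
  truth-step ([ ψ ] var p) ih =
    truth-reduce (A5 ψ p) (λ x → ⊨A5 x ψ p) (ih (≺-A5 ψ p))
  truth-step ([ ψ ] (¬' χ)) ih =
    truth-reduce (A6 ψ χ) (λ x → ⊨A6 x ψ χ) (ih (≺-A6 ψ χ))
  truth-step ([ ψ ] (φ ∧' χ)) ih =
    truth-reduce (A7 ψ φ χ) (λ x → ⊨A7 x ψ φ χ) (ih (≺-A7 ψ φ χ))
  truth-step ([ ψ ] K a χ) ih =
    truth-reduce (A8 ψ a χ) (λ x → ⊨A8 x ψ a χ) (ih (≺-A8 ψ a χ))
  truth-step ([ ψ ] ([ χ ] θ)) ih =
    truth-reduce (A9 ψ χ θ) (λ x → ⊨A9 x ψ χ θ) (ih (≺-A9 ψ χ θ))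
  truth-step ([ ψ ] ([ G ∣ χ ] θ)) ih = truth-announced-conclusion ψ (rule5 G χ θ)
    (ih (≺-announced ψ ([ G ∣ χ ] θ))) λ f → ih (≺-announced-premise ψ (rule5 G χ θ) f)
  truth-step ([ ψ ] ([⟨ G ⟩] θ)) ih = truth-announced-conclusion ψ (rule6 G θ)
    (ih (≺-announced ψ ([⟨ G ⟩] θ))) λ f → ih (≺-announced-premise ψ (rule6 G θ) f)
  truth-step ([ G ∣ χ ] θ) ih = truth-conclusion (rule5 G χ θ) λ f → ih (≺-premise (rule5 G χ θ) f)
  truth-step ([⟨ G ⟩] θ) ih   = truth-conclusion (rule6 G θ) λ f → ih (≺-premise (rule6 G θ) f)

  truth : ∀ φ → Truth φ
  truth = All.wfRec ≺-wellFounded 0ℓ Truth truth-step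

proposition13 : ExcludedMiddle 0ℓ → {n : ℕ} (φ : Form n) → Valid φ → ⊢ φ
proposition13 lem {n} φ valid =
  em⇒dne lem λ ⊬φ → refuted (lindenbaum (¬' φ) λ ⊢¬¬φ → ⊬φ (R0 (¬¬-elim φ) ⊢¬¬φ))
  where
  open Canonical lem {n}
  open Lindenbaum lem ⊢-theory using (lindenbaum)
  refuted : Extension ⊢_ (¬' φ) → ⊥
  refuted E = to (∋-¬ x) contains-δ (from (truth φ x) (valid Mᶜ x))
    where
    open Extension E
    x : World
    x = set , mcs
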